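{- Let $\mathbb{T}$ be a partial tableau and $\mathbf{n}$ an internal proof node of $\mathbb{T}$. If all children of $\mathbf{n}$ are valid, then $\mathbf{n}$ is valid.
   Context: Fix a set $\Sigma$ and a countably infinite set $\mathrm{Var}$. An LTS is $\mathcal{T}=(\mathcal{S},\to)$, $\to\subseteq\mathcal{S}\times\Sigma\times\mathcal{S}$; $s\xrightarrow{K}s'$ means some $a\in K$ with $(s,a,s')\in\to$. Formulas: $Z\mid\neg\Phi\mid\Phi\wedge\Phi\mid[K]\Phi\mid\nu Z.\Phi$, well-formed when bound variables occur positively; derived $\vee$, $\langle K\rangle\Phi=\neg[K]\neg\Phi$, $\mu Z.\Phi=\neg\nu Z.\neg\Phi[Z:=\neg Z]$; positive normal form: built from $Z,\neg Z,\wedge,\vee,[K],\langle K\rangle,\nu,\mu$. For valuation $V\colon\mathrm{Var}\to2^{\mathcal{S}}$ the standard semantics: $[\![[K]\Phi]\!]_V=\{s\mid\forall s'(s\xrightarrow{K}s'\Rightarrow s'\in[\![\Phi]\!]_V)\}$, $[\![\nu Z.\Phi]\!]_V=\bigcup\{S\mid S\subseteq[\![\Phi]\!]_{V[Z:=S]}\}$, etc. A definition list is $\Delta=(U_1=\Phi_1)\cdots(U_n=\Phi_n)$ with distinct $U_i\in\mathrm{Var}$, no $U_i$ bound in any $\Phi_j$, and $U_j$ not free in $\Phi_i$ when $i\le j$; $\Delta(U_i)=\Phi_i$; $\epsilon$ is the empty list; $V[\epsilon]=V$, $V[(U=\Phi)\cdot\Delta']=(V[U:=[\![\Phi]\!]_V])[\Delta']$.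 A sequent is $S\vdash_\Delta\Phi$ with $S\subseteq\mathcal{S}$, $\Phi$ in positive normal form, each $U\in\mathrm{dom}(\Delta)$ positive and not bound in $\Phi$; it is valid if $S\subseteq[\![\Phi]\!]_{V[\Delta]}$. Proof rules (conclusion from premises, in order): ($\wedge$) $S\vdash_\Delta\Phi_1\wedge\Phi_2$ from $S\vdash_\Delta\Phi_1$, $S\vdash_\Delta\Phi_2$; ($\vee$) $S\vdash_\Delta\Phi_1\vee\Phi_2$ from $S_1\vdash_\Delta\Phi_1$, $S_2\vdash_\Delta\Phi_2$ with $S=S_1\cup S_2$; ($[K]$) $S\vdash_\Delta[K]\Phi$ from $S'\vdash_\Delta\Phi$, $S'=\{s'\mid\exists s\in S.\ s\xrightarrow{K}s'\}$; ($\langle K\rangle,f$) $S\vdash_\Delta\langle K\rangle\Phi$ from $f(S)\vdash_\Delta\Phi$ where $f\colon S\to\mathcal{S}$ with $s\xrightarrow{K}f(s)$ for all $s\in S$; ($\sigma Z$) $S\vdash_\Delta\sigma Z.\Phi$ from $S\vdash_{\Delta\cdot(U=\sigma Z.\Phi)}U$ with $U$ fresh; (Un) $S\vdash_\Delta U$ from $S\vdash_\Delta\Phi[Z:=U]$ where $\Delta(U)=\sigma Z.\Phi$; (Thin) $S\vdash_\Delta\Phi$ from $S'\vdash_\Delta\Phi$ where $S\subseteq S'$. A partial tableau (for fixed $\mathcal{T}$, $V$) is a finite nonempty ordered tree whose nodes are labeled by sequents and whose internal nodes are labeled by rule applications such that the node's sequent and its children's sequents (in order) form an instance of the rule satisfying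 its side condition; leaves carry no rule. A node is valid iff its sequent is valid. -}

module Defs where

open import Level using (0ℓ)
open import Data.Bool using (Bool; true; false; not; _∧_; if_then_else_; T)
open import Data.Nat using (ℕ; _≟_)
open import Data.Fin using (Fin; _≤_)
open import Data.Maybe using (Maybe; just; nothing)
open import Data.List using (List; []; _∷_; map; lookup; _++_; [_])
open import Data.List.Membership.Propositional using (_∈_)
open import Data.List.Relation.Unary.Any using (Any)
open import Data.List.Relation.Unary.All using (All)
open import Data.Product using (Σ; ∃; ∃-syntax; _×_; _,_; proj₁; proj₂)
open import Data.Sum using (_⊎_)
open import Data.Empty using (⊥)
open import Data.Unit using (⊤)
open import Relation.Nullary using (¬_; Dec; does)
open import Relation.Unary using (Pred; _⊆_; _≐_; _∪_)
open import Relation.Binary.PropositionalEquality using (_≡_; _≢_)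

-- The paper's semantics is set-theoretic and
-- classical (greatest fixpoints as unions of arbitrary sets of states,
-- μ as a complement).  We represent semantic state sets as Boolean
-- characteristic functions and assume a global decision oracle.

LEM : Set₁
LEM = (A : Set) → Dec A

Var : Set
Var = ℕ

_==_ : Var → Var → Bool
x == y = does (x ≟ y)

record LTS (Act : Set) : Set₁ where
  field
    State : Set
    _⟶⟨_⟩_ : State → Act → State → Set

open LTS public

_⊢_─⟨_⟩→_ : {Act : Set} (𝒯 : LTS Act) → State 𝒯 → Pred Act 0ℓ → State 𝒯 → Set
𝒯 ⊢ s ─⟨ K ⟩→ s' = ∃[ a ] (K a × LTS._⟶⟨_⟩_ 𝒯 s a s')

data Form (Act : Set) : Set₁ where
  var  : Var → Form Act
  neg  : Form Act → Form Act
  and  : Form Act → Form Act → Form Act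
  box  : Pred Act 0ℓ → Form Act → Form Act
  nu   : Var → Form Act → Form Act

module _ {Act : Set} where

  -- Φ[Z := Ψ] (capture is irrelevant for the uses below: Ψ is ¬Z)
  sub : Form Act → Var → Form Act → Form Act
  sub (var Y)   Z ψ = if Y == Z then ψ else var Y
  sub (neg φ)   Z ψ = neg (sub φ Z ψ)
  sub (and φ χ) Z ψ = and (sub φ Z ψ) (sub χ Z ψ)
  sub (box K φ) Z ψ = box K (sub φ Z ψ)
  sub (nu Y φ)  Z ψ = if Y == Z then nu Y φ else nu Y (sub φ Z ψ)

  _∨F_ : Form Act → Form Act → Form Act
  φ ∨F ψ = neg (and (neg φ) (neg ψ))

  dia : Pred Act 0ℓ → Form Act → Form Act
  dia K φ = neg (box K (neg φ))

  mu : Var → Form Act → Form Act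
  mu Z φ = neg (nu Z (neg (sub φ Z (neg (var Z)))))

  -- Occ p Z φ : Z has a free occurrence in φ of polarity p
  -- (true = positive, i.e. under an even number of negations)
  Occ : Bool → Var → Form Act → Set
  Occ p Z (var Y)   = (p ≡ true) × (Y ≡ Z)
  Occ p Z (neg φ)   = Occ (not p) Z φ
  Occ p Z (and φ ψ) = Occ p Z φ ⊎ Occ p Z ψ
  Occ p Z (box K φ) = Occ p Z φ
  Occ p Z (nu Y φ)  = (Y ≢ Z) × Occ p Z φ

  Free : Var → Form Act → Set
  Free Z φ = Occ true Z φ ⊎ Occ false Z φ

  Positive : Var → Form Act → Set
  Positive Z φ = ¬ Occ false Z φ

  Bound : Var → Form Act → Set
  Bound Z (var Y)   = ⊥
  Bound Z (neg φ)   = Bound Z φ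
  Bound Z (and φ ψ) = Bound Z φ ⊎ Bound Z ψ
  Bound Z (box K φ) = Bound Z φ
  Bound Z (nu Y φ)  = (Y ≡ Z) ⊎ Bound Z φ

  WF : Form Act → Set
  WF (var Y)   = ⊤
  WF (neg φ)   = WF φ
  WF (and φ ψ) = WF φ × WF ψ
  WF (box K φ) = WF φ
  WF (nu Z φ)  = Positive Z φ × WF φ

data PNF (Act : Set) : Set₁ where
  pvar  : Var → PNF Act
  pneg  : Var → PNF Act
  _∧ₚ_  : PNF Act → PNF Act → PNF Act
  _∨ₚ_  : PNF Act → PNF Act → PNF Act
  [_]ₚ_ : Pred Act 0ℓ → PNF Act → PNF Act
  ⟨_⟩ₚ_ : Pred Act 0ℓ → PNF Act → PNF Act
  νₚ    : Var → PNF Act → PNF Act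
  μₚ    : Var → PNF Act → PNF Act

module _ {Act : Set} where

  ⌜_⌝ : PNF Act → Form Act
  ⌜ pvar Z ⌝    = var Z
  ⌜ pneg Z ⌝    = neg (var Z)
  ⌜ φ ∧ₚ ψ ⌝    = and ⌜ φ ⌝ ⌜ ψ ⌝
  ⌜ φ ∨ₚ ψ ⌝    = ⌜ φ ⌝ ∨F ⌜ ψ ⌝
  ⌜ [ K ]ₚ φ ⌝  = box K ⌜ φ ⌝
  ⌜ ⟨ K ⟩ₚ φ ⌝  = dia K ⌜ φ ⌝
  ⌜ νₚ Z φ ⌝    = nu Z ⌜ φ ⌝
  ⌜ μₚ Z φ ⌝    = mu Z ⌜ φ ⌝

  rename : PNF Act → Var → Var → PNF Act
  rename (pvar Y)     Z U = if Y == Z then pvar U else pvar Y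
  rename (pneg Y)     Z U = if Y == Z then pneg U else pneg Y
  rename (φ ∧ₚ ψ)     Z U = rename φ Z U ∧ₚ rename ψ Z U
  rename (φ ∨ₚ ψ)     Z U = rename φ Z U ∨ₚ rename ψ Z U
  rename ([ K ]ₚ φ)   Z U = [ K ]ₚ rename φ Z U
  rename (⟨ K ⟩ₚ φ)   Z U = ⟨ K ⟩ₚ rename φ Z U
  rename (νₚ Y φ)     Z U = if Y == Z then νₚ Y φ else νₚ Y (rename φ Z U)
  rename (μₚ Y φ)     Z U = if Y == Z then μₚ Y φ else μₚ Y (rename φ Z U)

DefList : Set → Set₁
DefList Act = List (Var × Form Act)

module _ {Act : Set} where

  dom : DefList Act → List Var
  dom = map proj₁

  IsDefList : DefList Act → Set
  IsDefList Δ =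
      (∀ i j → proj₁ (lookup Δ i) ≡ proj₁ (lookup Δ j) → i ≡ j)
    × (∀ i j → ¬ Bound (proj₁ (lookup Δ i)) (proj₂ (lookup Δ j)))
    × (∀ i j → i ≤ j → ¬ Free (proj₁ (lookup Δ j)) (proj₂ (lookup Δ i)))
    × (∀ i → WF (proj₂ (lookup Δ i)))

  look : DefList Act → Var → Maybe (Form Act)
  look []            U = nothing
  look ((W , φ) ∷ Δ) U = if W == U then just φ else look Δ U

record Sequent {Act : Set} (𝒯 : LTS Act) : Set₁ where
  constructor _⊢[_]_
  field
    set  : Pred (State 𝒯) 0ℓ
    defs : DefList Act
    fml  : PNF Act

open Sequent public

module _ {Act : Set} {𝒯 : LTS Act} where

  WFSeq : Sequent 𝒯 → Set
  WFSeq (S ⊢[ Δ ] φ) =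
      IsDefList Δ × WF ⌜ φ ⌝
    × (∀ U → U ∈ dom Δ → Positive U ⌜ φ ⌝ × ¬ Bound U ⌜ φ ⌝)

  Fresh : Var → DefList Act → Form Act → Set
  Fresh U Δ φ = ¬ (U ∈ dom Δ) × ¬ Free U φ × ¬ Bound U φ
              × (∀ i → ¬ Free U (proj₂ (lookup Δ i)) × ¬ Bound U (proj₂ (lookup Δ i)))

  data Step : Sequent 𝒯 → List (Sequent 𝒯) → Set₁ where
    ∧-rule : ∀ {S Δ φ₁ φ₂} →
      Step (S ⊢[ Δ ] (φ₁ ∧ₚ φ₂)) ((S ⊢[ Δ ] φ₁) ∷ (S ⊢[ Δ ] φ₂) ∷ [])
    ∨-rule : ∀ {S S₁ S₂ Δ φ₁ φ₂} → S ≐ (S₁ ∪ S₂) →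
      Step (S ⊢[ Δ ] (φ₁ ∨ₚ φ₂)) ((S₁ ⊢[ Δ ] φ₁) ∷ (S₂ ⊢[ Δ ] φ₂) ∷ [])
    box-rule : ∀ {S S' Δ K φ} →
      S' ≐ (λ s' → ∃[ s ] (S s × 𝒯 ⊢ s ─⟨ K ⟩→ s')) →
      Step (S ⊢[ Δ ] ([ K ]ₚ φ)) ((S' ⊢[ Δ ] φ) ∷ [])
    dia-rule : ∀ {S S' Δ K φ} (f : (s : State 𝒯) → S s → State 𝒯) →
      (∀ s (p : S s) → 𝒯 ⊢ s ─⟨ K ⟩→ f s p) →
      S' ≐ (λ t → ∃[ s ] Σ (S s) (λ p → f s p ≡ t)) →
      Step (S ⊢[ Δ ] (⟨ K ⟩ₚ φ)) ((S' ⊢[ Δ ] φ) ∷ [])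
    ν-rule : ∀ {S Δ Z φ} (U : Var) → Fresh U Δ ⌜ νₚ Z φ ⌝ →
      Step (S ⊢[ Δ ] νₚ Z φ) ((S ⊢[ Δ ++ [ (U , ⌜ νₚ Z φ ⌝) ] ] pvar U) ∷ [])
    μ-rule : ∀ {S Δ Z φ} (U : Var) → Fresh U Δ ⌜ μₚ Z φ ⌝ →
      Step (S ⊢[ Δ ] μₚ Z φ) ((S ⊢[ Δ ++ [ (U , ⌜ μₚ Z φ ⌝) ] ] pvar U) ∷ [])
    Un-ν : ∀ {S Δ U Z φ} → look Δ U ≡ just ⌜ νₚ Z φ ⌝ →
      Step (S ⊢[ Δ ] pvar U) ((S ⊢[ Δ ] rename φ Z U) ∷ [])
    Un-μ : ∀ {S Δ U Z φ} → look Δ U ≡ just ⌜ μₚ Z φ ⌝ →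
      Step (S ⊢[ Δ ] pvar U) ((S ⊢[ Δ ] rename φ Z U) ∷ [])
    Thin : ∀ {S S' Δ φ} → S ⊆ S' →
      Step (S ⊢[ Δ ] φ) ((S' ⊢[ Δ ] φ) ∷ [])

module _ {Act : Set} (𝒯 : LTS Act) where

  mutual
    data Tableau : Set₁ where
      leaf  : (s : Sequent 𝒯) → WFSeq s → Tableau
      inode : (s : Sequent 𝒯) → WFSeq s → (ts : List Tableau) →
              Step s (map root ts) → Tableau

    root : Tableau → Sequent 𝒯
    root (leaf s _)        = s
    root (inode s _ _ _)   = s

  children : Tableau → List Tableau
  children (leaf _ _)       = []
  children (inode _ _ ts _) = ts

  data _∈ₜ_ (n : Tableau) : Tableau → Set₁ where
    here  : n ∈ₜ n
    there : ∀ {s w ts st} → Any (n ∈ₜ_) ts → n ∈ₜ inode s w ts st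

  data Internal : Tableau → Set₁ where
    internal : ∀ {s w ts st} → Internal (inode s w ts st)

module _ (lem : LEM) {Act : Set} (𝒯 : LTS Act) where

  Valuation : Set
  Valuation = Var → State 𝒯 → Bool

  _[_≔_] : Valuation → Var → (State 𝒯 → Bool) → Valuation
  (V [ Z ≔ X ]) Y = if Y == Z then X else V Y

  ⟦_⟧ : Form Act → Valuation → State 𝒯 → Bool
  ⟦ var Z ⟧   V = V Z
  ⟦ neg φ ⟧   V s = not (⟦ φ ⟧ V s)
  ⟦ and φ ψ ⟧ V s = ⟦ φ ⟧ V s ∧ ⟦ ψ ⟧ V s
  ⟦ box K φ ⟧ V s = does (lem (∀ s' → 𝒯 ⊢ s ─⟨ K ⟩→ s' → T (⟦ φ ⟧ V s')))
  ⟦ nu Z φ ⟧  V s = does (lem (Σ (State 𝒯 → Bool) λ X →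
                       T (X s) × (∀ t → T (X t) → T (⟦ φ ⟧ (V [ Z ≔ X ]) t))))

  _⟨_⟩ : Valuation → DefList Act → Valuation
  V ⟨ [] ⟩          = V
  V ⟨ (U , φ) ∷ Δ ⟩ = (V [ U ≔ ⟦ φ ⟧ V ]) ⟨ Δ ⟩

  Valid : Valuation → Sequent 𝒯 → Set
  Valid V (S ⊢[ Δ ] φ) = ∀ s → S s → T (⟦ ⌜ φ ⌝ ⟧ (V ⟨ Δ ⟩) s)

-- Every rule is locally sound, so the validity of an internal node follows
-- from that of its children by inspecting the rule applied there.  The only
-- cases with content are the unfolding rules.  If Δ(U) = σZ.Φ then, because
-- definition lists are acyclic with distinct variables, U denotes ⟦σZ.Φ⟧
-- under V[Δ]; hence Φ[Z:=U] denotes Φ applied to that fixpoint.  Since Z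
-- occurs positively, Φ is monotone in Z, and by Knaster–Tarski applying Φ to
-- its greatest fixpoint lands inside it.  For μ the same argument is run on
-- the complemented body, whose greatest fixpoint is the complement of ⟦μZ.Φ⟧.

module Submission where

open import Defs
open import Level using (0ℓ)
open import Data.Bool using (Bool; true; false; not; _∧_; T)
open import Data.Bool.Properties using (T-∧; not-involutive)
open import Data.Empty using (⊥-elim)
open import Data.Fin using (zero; suc)
open import Data.Fin.Properties using (0≢1+n; suc-injective)
open import Data.List using ([]; _∷_; lookup; _++_; [_])
open import Data.List.Relation.Unary.All using (All; []; _∷_)
open import Data.List.Relation.Unary.All.Properties using (map⁺)
open import Data.Maybe using (just)
open import Data.Nat using (_≟_; z≤n; s≤s)
open import Data.Product using (Σ; _×_; _,_; proj₁; proj₂)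
import Data.Product as Product
open import Data.Sum using (_⊎_; inj₁; inj₂)
import Data.Sum as Sum
open import Function using (_∘_; id)
open import Function.Bundles using (Equivalence; mk⇔)
open import Relation.Nullary using (¬_; does; proof; yes; no; ofʸ; ofⁿ)
open import Relation.Nullary.Decidable using (does-⇔)
open import Relation.Unary using (Pred)
open import Relation.Binary.PropositionalEquality
  using (_≡_; _≢_; _≗_; refl; sym; trans; cong; cong₂; cong-app; subst; module ≡-Reasoning)

open Equivalence using (to; from)

T-not⁺ : ∀ {b} → ¬ T b → T (not b)
T-not⁺ {false} _  = _
T-not⁺ {true}  ¬b = ¬b _

T-not⁻ : ∀ {b} → T (not b) → ¬ T b
T-not⁻ {false} _ ()
T-not⁻ {true}  ()

not-antitone : ∀ {a b} → (T a → T b) → T (not b) → T (not a)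
not-antitone a⇒b ¬b = T-not⁺ (T-not⁻ ¬b ∘ a⇒b)

∧-mono : ∀ {a a′ b b′} → (T a → T a′) → (T b → T b′) → T (a ∧ b) → T (a′ ∧ b′)
∧-mono f g = from T-∧ ∘ Product.map f g ∘ to T-∧

not-∧-not-intro : ∀ a b → T a ⊎ T b → T (not (not a ∧ not b))
not-∧-not-intro true  _     _        = _
not-∧-not-intro false true  _        = _
not-∧-not-intro false false (inj₁ ())
not-∧-not-intro false false (inj₂ ())

module _ (lem : LEM) {Act : Set} (𝒯 : LTS Act) where

  StateSet : Set
  StateSet = State 𝒯 → Bool

  Val : Set
  Val = Valuation lem 𝒯

  ⟦_⟧ᶠ : Form Act → Val → StateSet
  ⟦_⟧ᶠ = ⟦_⟧ lem 𝒯

  infixl 5 _[_↦_]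
  _[_↦_] : Val → Var → StateSet → Val
  _[_↦_] = _[_≔_] lem 𝒯

  _⟪_⟫ : Val → DefList Act → Val
  _⟪_⟫ = _⟨_⟩ lem 𝒯

  decided : {A : Set} → T (does (lem A)) → A
  decided {A} t with lem A
  ... | yes a = a

  decide : {A : Set} → A → T (does (lem A))
  decide {A} a with lem A
  ... | yes _ = _
  ... | no ¬a = ¬a a

  decided-map : {A B : Set} → (A → B) → T (does (lem A)) → T (does (lem B))
  decided-map f = decide ∘ f ∘ decided

  infix 4 _⊑_
  _⊑_ : StateSet → StateSet → Set
  X ⊑ Y = ∀ s → T (X s) → T (Y s)

  ≗⇒⊑ : {X Y : StateSet} → X ≗ Y → X ⊑ Y
  ≗⇒⊑ X≗Y s = subst T (X≗Y s)

  -- ⟦ box K φ ⟧ V and ⟦ nu Z φ ⟧ V are definitionally □ K (⟦ φ ⟧ V) and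
  -- gfp (λ X → ⟦ φ ⟧ (V [ Z ≔ X ])), so the lemmas below apply to them directly.
  AllSuccessors : Pred Act 0ℓ → StateSet → State 𝒯 → Set
  AllSuccessors K X s = ∀ s′ → 𝒯 ⊢ s ─⟨ K ⟩→ s′ → T (X s′)

  □ : Pred Act 0ℓ → StateSet → StateSet
  □ K X s = does (lem (AllSuccessors K X s))

  InPostFixpoint : (StateSet → StateSet) → State 𝒯 → Set
  InPostFixpoint F s = Σ StateSet λ X → T (X s) × X ⊑ F X

  gfp : (StateSet → StateSet) → StateSet
  gfp F s = does (lem (InPostFixpoint F s))

  AllSuccessors-map : ∀ {K X Y} → X ⊑ Y → ∀ {s} → AllSuccessors K X s → AllSuccessors K Y s
  AllSuccessors-map X⊑Y all s′ step = X⊑Y s′ (all s′ step)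

  InPostFixpoint-map : ∀ {F G} → (∀ X → F X ⊑ G X) →
                       ∀ {s} → InPostFixpoint F s → InPostFixpoint G s
  InPostFixpoint-map F⊑G (X , Xs , post) = X , Xs , λ t Xt → F⊑G X t (post t Xt)

  □-mono : ∀ K {X Y} → X ⊑ Y → □ K X ⊑ □ K Y
  □-mono K X⊑Y s = decided-map (AllSuccessors-map X⊑Y)

  □-cong : ∀ K {X Y} → X ≗ Y → □ K X ≗ □ K Y
  □-cong K X≗Y s = does-⇔
    (mk⇔ (AllSuccessors-map (≗⇒⊑ X≗Y)) (AllSuccessors-map (≗⇒⊑ (sym ∘ X≗Y)))) (lem _) (lem _)

  gfp-mono : ∀ {F G} → (∀ X → F X ⊑ G X) → gfp F ⊑ gfp G
  gfp-mono F⊑G s = decided-map (InPostFixpoint-map F⊑G)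

  gfp-cong : ∀ {F G} → (∀ X → F X ≗ G X) → gfp F ≗ gfp G
  gfp-cong F≗G s = does-⇔
    (mk⇔ (InPostFixpoint-map (≗⇒⊑ ∘ F≗G)) (InPostFixpoint-map (λ X → ≗⇒⊑ (sym ∘ F≗G X))))
    (lem _) (lem _)

  Monotone : (StateSet → StateSet) → Set
  Monotone F = ∀ {X Y} → X ⊑ Y → F X ⊑ F Y

  gfp-unfold : ∀ {F} → Monotone F → gfp F ⊑ F (gfp F)
  gfp-unfold mono s t =
    let (X , Xs , post) = decided t
    in mono (λ u Xu → decide (X , Xu , post)) s (post s Xs)

  gfp-fold : ∀ {F} → Monotone F → F (gfp F) ⊑ gfp F
  gfp-fold {F} mono s t = decide (F (gfp F) , t , mono (gfp-unfold mono))

  infix 4 _≈_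
  _≈_ : Val → Val → Set
  V ≈ V′ = ∀ Y → V Y ≗ V′ Y

  ↦-at : (R : StateSet → StateSet → Set) (V V′ : Val) → ∀ {Z X X′} Y →
         (Y ≡ Z → R X X′) → (Y ≢ Z → R (V Y) (V′ Y)) →
         R ((V [ Z ↦ X ]) Y) ((V′ [ Z ↦ X′ ]) Y)
  ↦-at R V V′ {Z} Y same other with Y == Z | proof (Y ≟ Z)
  ... | true  | ofʸ Y≡Z = same Y≡Z
  ... | false | ofⁿ Y≢Z = other Y≢Z

  ↦-same : ∀ V Z X → (V [ Z ↦ X ]) Z ≡ X
  ↦-same V Z X with Z == Z | proof (Z ≟ Z)
  ... | true  | _        = refl
  ... | false | ofⁿ Z≢Z = ⊥-elim (Z≢Z refl)

  ↦-other : ∀ V {Y Z} X → Y ≢ Z → (V [ Z ↦ X ]) Y ≡ V Y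
  ↦-other V {Y} {Z} X Y≢Z with Y == Z | proof (Y ≟ Z)
  ... | true  | ofʸ Y≡Z = ⊥-elim (Y≢Z Y≡Z)
  ... | false | _       = refl

  ↦-cong : ∀ {V V′} Z {X X′} → V ≈ V′ → X ≗ X′ → V [ Z ↦ X ] ≈ V′ [ Z ↦ X′ ]
  ↦-cong {V} {V′} Z V≈V′ X≗X′ Y = ↦-at _≗_ V V′ Y (λ _ → X≗X′) (λ _ → V≈V′ Y)

  ↦-overwrite : ∀ V Z X X′ → V [ Z ↦ X ] [ Z ↦ X′ ] ≈ V [ Z ↦ X′ ]
  ↦-overwrite V Z X X′ Y =
    ↦-at _≗_ (V [ Z ↦ X ]) V Y (λ _ _ → refl) (λ Y≢Z → cong-app (↦-other V X Y≢Z))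

  ↦-comm : ∀ V {Y Z} X X′ → Y ≢ Z → V [ Y ↦ X ] [ Z ↦ X′ ] ≈ V [ Z ↦ X′ ] [ Y ↦ X ]
  ↦-comm V {Y} {Z} X X′ Y≢Z W s with W == Z | proof (W ≟ Z) | W == Y | proof (W ≟ Y)
  ... | true  | ofʸ refl | true  | ofʸ refl = ⊥-elim (Y≢Z refl)
  ... | true  | _        | false | _        = refl
  ... | false | _        | true  | _        = refl
  ... | false | _        | false | _        = refl

  ⟦⟧-coincidence : ∀ φ {V V′} → (∀ Y → Free Y φ → V Y ≗ V′ Y) → ⟦ φ ⟧ᶠ V ≗ ⟦ φ ⟧ᶠ V′
  ⟦⟧-coincidence (var Y)   h = h Y (inj₁ (refl , refl))
  ⟦⟧-coincidence (neg φ)   h s = cong not (⟦⟧-coincidence φ (λ Y → h Y ∘ Sum.swap) s)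
  ⟦⟧-coincidence (and φ ψ) h s = cong₂ _∧_
    (⟦⟧-coincidence φ (λ Y → h Y ∘ Sum.map inj₁ inj₁) s)
    (⟦⟧-coincidence ψ (λ Y → h Y ∘ Sum.map inj₂ inj₂) s)
  ⟦⟧-coincidence (box K φ) h = □-cong K (⟦⟧-coincidence φ h)
  ⟦⟧-coincidence (nu Z φ) {V} {V′} h = gfp-cong λ X → ⟦⟧-coincidence φ λ Y f →
    ↦-at _≗_ V V′ Y (λ _ _ → refl) (λ Y≢Z → h Y (Sum.map (Y≢Z ∘ sym ,_) (Y≢Z ∘ sym ,_) f))

  ⟦⟧-cong : ∀ φ {V V′} → V ≈ V′ → ⟦ φ ⟧ᶠ V ≗ ⟦ φ ⟧ᶠ V′
  ⟦⟧-cong φ V≈V′ = ⟦⟧-coincidence φ (λ Y _ → V≈V′ Y)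

  ⟦⟧-↦-nonfree : ∀ φ {V Z} X → ¬ Free Z φ → ⟦ φ ⟧ᶠ (V [ Z ↦ X ]) ≗ ⟦ φ ⟧ᶠ V
  ⟦⟧-↦-nonfree φ {V} X ¬free = ⟦⟧-coincidence φ λ Y free →
    cong-app (↦-other V X λ { refl → ¬free free })

  nu-binds : ∀ {Z} (φ : Form Act) → ¬ Free Z (nu Z φ)
  nu-binds _ (inj₁ (Z≢Z , _)) = Z≢Z refl
  nu-binds _ (inj₂ (Z≢Z , _)) = Z≢Z refl

  infix 4 _≤⟨_⟩_
  _≤⟨_⟩_ : Val → Var → Val → Set
  V ≤⟨ Z ⟩ V′ = (∀ Y → Y ≢ Z → V Y ≗ V′ Y) × V Z ⊑ V′ Z

  ≤-↦ : ∀ {V V′ Z} Y X → V ≤⟨ Z ⟩ V′ → V [ Y ↦ X ] ≤⟨ Z ⟩ V′ [ Y ↦ X ]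
  ≤-↦ {V} {V′} {Z} Y X (agree , below) =
    (λ W W≢Z → ↦-at _≗_ V V′ W (λ _ _ → refl) (λ _ → agree W W≢Z)) ,
    ↦-at _⊑_ V V′ Z (λ _ _ → id) (λ _ → below)

  ≤-shadow : ∀ {V V′ Z} X → V ≤⟨ Z ⟩ V′ → V [ Z ↦ X ] ≈ V′ [ Z ↦ X ]
  ≤-shadow {V} {V′} X (agree , _) Y = ↦-at _≗_ V V′ Y (λ _ _ → refl) (agree Y)

  ≤-↦-self : ∀ V Z {X X′} → X ⊑ X′ → V [ Z ↦ X ] ≤⟨ Z ⟩ V [ Z ↦ X′ ]
  ≤-↦-self V Z X⊑X′ =
    (λ Y Y≢Z → ↦-at _≗_ V V Y (⊥-elim ∘ Y≢Z) (λ _ _ → refl)) ,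
    ↦-at _⊑_ V V Z (λ _ → X⊑X′) (λ Z≢Z → ⊥-elim (Z≢Z refl))

  ⟦⟧-monotone : ∀ φ {Z V V′} → ¬ Occ false Z φ → V ≤⟨ Z ⟩ V′ → ⟦ φ ⟧ᶠ V ⊑ ⟦ φ ⟧ᶠ V′
  ⟦⟧-antitone : ∀ φ {Z V V′} → ¬ Occ true Z φ → V ≤⟨ Z ⟩ V′ → ⟦ φ ⟧ᶠ V′ ⊑ ⟦ φ ⟧ᶠ V

  ⟦⟧-monotone (var Y) {Z} _ (agree , below) with Y ≟ Z
  ... | yes refl = below
  ... | no Y≢Z   = ≗⇒⊑ (agree Y Y≢Z)
  ⟦⟧-monotone (neg φ)   nonneg r s = not-antitone (⟦⟧-antitone φ nonneg r s)
  ⟦⟧-monotone (and φ ψ) nonneg r s =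
    ∧-mono (⟦⟧-monotone φ (nonneg ∘ inj₁) r s) (⟦⟧-monotone ψ (nonneg ∘ inj₂) r s)
  ⟦⟧-monotone (box K φ) nonneg r = □-mono K (⟦⟧-monotone φ nonneg r)
  ⟦⟧-monotone (nu Y φ) {Z} nonneg r with Y ≟ Z
  ... | yes refl = gfp-mono λ X → ≗⇒⊑ (⟦⟧-cong φ (≤-shadow X r))
  ... | no Y≢Z   = gfp-mono λ X → ⟦⟧-monotone φ (nonneg ∘ (Y≢Z ,_)) (≤-↦ Y X r)

  ⟦⟧-antitone (var Y) {Z} nonpos (agree , _) with Y ≟ Z
  ... | yes Y≡Z = ⊥-elim (nonpos (refl , Y≡Z))
  ... | no Y≢Z  = ≗⇒⊑ (sym ∘ agree Y Y≢Z)
  ⟦⟧-antitone (neg φ)   nonpos r s = not-antitone (⟦⟧-monotone φ nonpos r s)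
  ⟦⟧-antitone (and φ ψ) nonpos r s =
    ∧-mono (⟦⟧-antitone φ (nonpos ∘ inj₁) r s) (⟦⟧-antitone ψ (nonpos ∘ inj₂) r s)
  ⟦⟧-antitone (box K φ) nonpos r = □-mono K (⟦⟧-antitone φ nonpos r)
  ⟦⟧-antitone (nu Y φ) {Z} nonpos r with Y ≟ Z
  ... | yes refl = gfp-mono λ X → ≗⇒⊑ (sym ∘ ⟦⟧-cong φ (≤-shadow X r))
  ... | no Y≢Z   = gfp-mono λ X → ⟦⟧-antitone φ (nonpos ∘ (Y≢Z ,_)) (≤-↦ Y X r)

  ⟦⟧-↦-monotone : ∀ φ {V Z} → Positive Z φ → Monotone (λ X → ⟦ φ ⟧ᶠ (V [ Z ↦ X ]))
  ⟦⟧-↦-monotone φ {V} {Z} nonneg X⊑X′ = ⟦⟧-monotone φ nonneg (≤-↦-self V Z X⊑X′)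

  ⟦⟧-sub-neg : ∀ φ {V} Y → ⟦ sub φ Y (neg (var Y)) ⟧ᶠ V ≗ ⟦ φ ⟧ᶠ (V [ Y ↦ not ∘ V Y ])
  ⟦⟧-sub-neg (var Y′) Y s with Y′ == Y
  ... | true  = refl
  ... | false = refl
  ⟦⟧-sub-neg (neg φ)   Y s = cong not (⟦⟧-sub-neg φ Y s)
  ⟦⟧-sub-neg (and φ ψ) Y s = cong₂ _∧_ (⟦⟧-sub-neg φ Y s) (⟦⟧-sub-neg ψ Y s)
  ⟦⟧-sub-neg (box K φ) Y   = □-cong K (⟦⟧-sub-neg φ Y)
  ⟦⟧-sub-neg (nu Y′ φ) {V} Y with Y′ == Y | proof (Y′ ≟ Y)
  ... | true  | ofʸ refl = sym ∘ ⟦⟧-↦-nonfree (nu Y φ) _ (nu-binds φ)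
  ... | false | ofⁿ Y′≢Y = gfp-cong λ X s → trans (⟦⟧-sub-neg φ Y s) (⟦⟧-cong φ (reorder X) s)
    where
    reorder : ∀ X → V [ Y′ ↦ X ] [ Y ↦ not ∘ (V [ Y′ ↦ X ]) Y ] ≈ V [ Y ↦ not ∘ V Y ] [ Y′ ↦ X ]
    reorder X W s = trans
      (↦-cong {V [ Y′ ↦ X ]} Y (λ _ _ → refl) (cong not ∘ cong-app (↦-other V X (Y′≢Y ∘ sym))) W s)
      (↦-comm V X (not ∘ V Y) Y′≢Y W s)

  ⟦⟧-sub-neg-↦ : ∀ φ {V} Y X →
    ⟦ sub φ Y (neg (var Y)) ⟧ᶠ (V [ Y ↦ X ]) ≗ ⟦ φ ⟧ᶠ (V [ Y ↦ not ∘ X ])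
  ⟦⟧-sub-neg-↦ φ {V} Y X s = trans (⟦⟧-sub-neg φ Y s) (⟦⟧-cong φ overwrite s)
    where
    overwrite : V [ Y ↦ X ] [ Y ↦ not ∘ (V [ Y ↦ X ]) Y ] ≈ V [ Y ↦ not ∘ X ]
    overwrite W t = trans
      (↦-cong {V [ Y ↦ X ]} Y (λ _ _ → refl) (cong not ∘ cong-app (↦-same V Y X)) W t)
      (↦-overwrite V Y X (not ∘ X) W t)

  Bound-sub⁺ : ∀ (φ : Form Act) Y ψ {U} → Bound U φ → Bound U (sub φ Y ψ)
  Bound-sub⁺ (var _)   _ _ ()
  Bound-sub⁺ (neg φ)   Y ψ = Bound-sub⁺ φ Y ψ
  Bound-sub⁺ (and φ χ) Y ψ = Sum.map (Bound-sub⁺ φ Y ψ) (Bound-sub⁺ χ Y ψ)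
  Bound-sub⁺ (box _ φ) Y ψ = Bound-sub⁺ φ Y ψ
  Bound-sub⁺ (nu Y′ φ) Y ψ b with Y′ == Y
  ... | true  = b
  ... | false = Sum.map₂ (Bound-sub⁺ φ Y ψ) b

  ↦-comm-copy : ∀ W {Y Z U} X → Y ≢ Z → U ≢ Y →
    W [ Y ↦ X ] [ Z ↦ (W [ Y ↦ X ]) U ] ≈ W [ Z ↦ W U ] [ Y ↦ X ]
  ↦-comm-copy W X Y≢Z U≢Y Y′ s = trans
    (↦-cong {W [ _ ↦ X ]} _ (λ _ _ → refl) (cong-app (↦-other W X U≢Y)) Y′ s)
    (↦-comm W X (W _) Y≢Z Y′ s)

  ⟦⟧-rename : ∀ φ {W Z U} → ¬ Bound U ⌜ φ ⌝ →
    ⟦ ⌜ rename φ Z U ⌝ ⟧ᶠ W ≗ ⟦ ⌜ φ ⌝ ⟧ᶠ (W [ Z ↦ W U ])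
  ⟦⟧-rename (pvar Y) {Z = Z} _ s with Y == Z
  ... | true  = refl
  ... | false = refl
  ⟦⟧-rename (pneg Y) {Z = Z} _ s with Y == Z
  ... | true  = refl
  ... | false = refl
  ⟦⟧-rename (φ ∧ₚ ψ) unbound s =
    cong₂ _∧_ (⟦⟧-rename φ (unbound ∘ inj₁) s) (⟦⟧-rename ψ (unbound ∘ inj₂) s)
  ⟦⟧-rename (φ ∨ₚ ψ) unbound s = cong not (cong₂ _∧_
    (cong not (⟦⟧-rename φ (unbound ∘ inj₁) s)) (cong not (⟦⟧-rename ψ (unbound ∘ inj₂) s)))
  ⟦⟧-rename ([ K ]ₚ φ) unbound = □-cong K (⟦⟧-rename φ unbound)
  ⟦⟧-rename (⟨ K ⟩ₚ φ) unbound s = cong not (□-cong K (cong not ∘ ⟦⟧-rename φ unbound) s)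
  ⟦⟧-rename (νₚ Y φ) {W} {Z} unbound with Y == Z | proof (Y ≟ Z)
  ... | true  | ofʸ refl = sym ∘ ⟦⟧-↦-nonfree ⌜ νₚ Y φ ⌝ _ (nu-binds ⌜ φ ⌝)
  ... | false | ofⁿ Y≢Z  = gfp-cong λ X s → trans
    (⟦⟧-rename φ (unbound ∘ inj₂) s)
    (⟦⟧-cong ⌜ φ ⌝ (↦-comm-copy W X Y≢Z (unbound ∘ inj₁ ∘ sym)) s)
  ⟦⟧-rename (μₚ Y φ) {W} {Z} {U} unbound with Y == Z | proof (Y ≟ Z)
  ... | true  | ofʸ refl =
    sym ∘ ⟦⟧-↦-nonfree ⌜ μₚ Y φ ⌝ _ (nu-binds (neg (sub ⌜ φ ⌝ Y (neg (var Y)))) ∘ Sum.swap)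
  ... | false | ofⁿ Y≢Z  = λ s → cong not (gfp-cong (λ X s → cong not (body X s)) s)
    where
    open ≡-Reasoning
    body : ∀ X → ⟦ sub ⌜ rename φ Z U ⌝ Y (neg (var Y)) ⟧ᶠ (W [ Y ↦ X ])
               ≗ ⟦ sub ⌜ φ ⌝ Y (neg (var Y)) ⟧ᶠ (W [ Z ↦ W U ] [ Y ↦ X ])
    body X s = begin
      ⟦ sub ⌜ rename φ Z U ⌝ Y (neg (var Y)) ⟧ᶠ (W [ Y ↦ X ]) s
        ≡⟨ ⟦⟧-sub-neg-↦ ⌜ rename φ Z U ⌝ Y X s ⟩
      ⟦ ⌜ rename φ Z U ⌝ ⟧ᶠ (W [ Y ↦ not ∘ X ]) s
        ≡⟨ ⟦⟧-rename φ (unbound ∘ inj₂ ∘ Bound-sub⁺ ⌜ φ ⌝ Y (neg (var Y)) {U}) s ⟩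
      ⟦ ⌜ φ ⌝ ⟧ᶠ (W [ Y ↦ not ∘ X ] [ Z ↦ (W [ Y ↦ not ∘ X ]) U ]) s
        ≡⟨ ⟦⟧-cong ⌜ φ ⌝ (↦-comm-copy W (not ∘ X) Y≢Z (unbound ∘ inj₁ ∘ sym)) s ⟩
      ⟦ ⌜ φ ⌝ ⟧ᶠ (W [ Z ↦ W U ] [ Y ↦ not ∘ X ]) s
        ≡⟨ ⟦⟧-sub-neg-↦ ⌜ φ ⌝ Y X s ⟨
      ⟦ sub ⌜ φ ⌝ Y (neg (var Y)) ⟧ᶠ (W [ Z ↦ W U ] [ Y ↦ X ]) s ∎

  nu-fold : ∀ φ {W Z} → Positive Z φ → ⟦ φ ⟧ᶠ (W [ Z ↦ ⟦ nu Z φ ⟧ᶠ W ]) ⊑ ⟦ nu Z φ ⟧ᶠ W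
  nu-fold φ nonneg = gfp-fold (⟦⟧-↦-monotone φ nonneg)

  mu-fold : ∀ φ {W Z} → Positive Z (neg (sub φ Z (neg (var Z)))) →
    ⟦ φ ⟧ᶠ (W [ Z ↦ ⟦ mu Z φ ⟧ᶠ W ]) ⊑ ⟦ mu Z φ ⟧ᶠ W
  mu-fold φ {W} {Z} nonneg s =
    not-antitone (gfp-unfold (⟦⟧-↦-monotone (neg (sub φ Z (neg (var Z)))) nonneg) s) ∘
    subst T (sym (trans (not-involutive _) (⟦⟧-sub-neg-↦ φ Z _ s)))

  rename-⊑-prefixpoint : ∀ φ {W Z U} ψ → ¬ Bound U ⌜ φ ⌝ → W U ≗ ⟦ ψ ⟧ᶠ W →
    ⟦ ⌜ φ ⌝ ⟧ᶠ (W [ Z ↦ ⟦ ψ ⟧ᶠ W ]) ⊑ ⟦ ψ ⟧ᶠ W →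
    ⟦ ⌜ rename φ Z U ⌝ ⟧ᶠ W ⊑ W U
  rename-⊑-prefixpoint φ {W} {Z} ψ unbound U≗ψ fold s =
    ≗⇒⊑ (sym ∘ U≗ψ) s ∘ fold s ∘ ≗⇒⊑ renamed s
    where
    renamed : ⟦ ⌜ rename φ Z _ ⌝ ⟧ᶠ W ≗ ⟦ ⌜ φ ⌝ ⟧ᶠ (W [ Z ↦ ⟦ ψ ⟧ᶠ W ])
    renamed t = trans (⟦⟧-rename φ unbound t) (⟦⟧-cong ⌜ φ ⌝ (↦-cong {W} Z (λ _ _ → refl) U≗ψ) t)

  IsDefList-tail : ∀ {d} {Δ : DefList Act} → IsDefList (d ∷ Δ) → IsDefList Δ
  IsDefList-tail (distinct , unbound , acyclic , wf) =
    (λ i j eq → suc-injective (distinct (suc i) (suc j) eq)) ,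
    (λ i j → unbound (suc i) (suc j)) ,
    (λ i j i≤j → acyclic (suc i) (suc j) (s≤s i≤j)) ,
    wf ∘ suc

  look-wf : ∀ (Δ : DefList Act) {U ψ} → IsDefList Δ → look Δ U ≡ just ψ → ¬ Bound U ψ × WF ψ
  look-wf [] _ ()
  look-wf ((W , χ) ∷ Δ) {U} dl eq with W == U | proof (W ≟ U) | eq
  ... | true  | ofʸ refl | refl = let (_ , unbound , _ , wf) = dl in unbound zero zero , wf zero
  ... | false | _        | eq′  = look-wf Δ (IsDefList-tail dl) eq′

  ⟪⟫-undefined : ∀ (Δ : DefList Act) {V Y} → (∀ j → Y ≢ proj₁ (lookup Δ j)) → (V ⟪ Δ ⟫) Y ≡ V Y
  ⟪⟫-undefined []            _     = refl
  ⟪⟫-undefined ((W , χ) ∷ Δ) {V} fresh =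
    trans (⟪⟫-undefined Δ (fresh ∘ suc)) (↦-other V (⟦ χ ⟧ᶠ V) (fresh zero))

  ⟪⟫-head : ∀ U χ (Δ : DefList Act) {V} → IsDefList ((U , χ) ∷ Δ) →
    (V ⟪ (U , χ) ∷ Δ ⟫) U ≗ ⟦ χ ⟧ᶠ (V ⟪ (U , χ) ∷ Δ ⟫)
  ⟪⟫-head U χ Δ {V} (distinct , _ , acyclic , _) s = begin
    ((V [ U ↦ ⟦ χ ⟧ᶠ V ]) ⟪ Δ ⟫) U s
      ≡⟨ cong-app (⟪⟫-undefined Δ λ j → 0≢1+n ∘ distinct zero (suc j)) s ⟩
    (V [ U ↦ ⟦ χ ⟧ᶠ V ]) U s
      ≡⟨ cong-app (↦-same V U (⟦ χ ⟧ᶠ V)) s ⟩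
    ⟦ χ ⟧ᶠ V s
      ≡⟨ ⟦⟧-coincidence χ (λ Y → cong-app ∘ sym ∘ defined-later Y) s ⟩
    ⟦ χ ⟧ᶠ ((V [ U ↦ ⟦ χ ⟧ᶠ V ]) ⟪ Δ ⟫) s ∎
    where
    open ≡-Reasoning
    defined-later : ∀ Y → Free Y χ → ((V [ U ↦ ⟦ χ ⟧ᶠ V ]) ⟪ Δ ⟫) Y ≡ V Y
    defined-later Y free = trans
      (⟪⟫-undefined Δ λ j Y≡Uⱼ → acyclic zero (suc j) z≤n (subst (λ Y → Free Y χ) Y≡Uⱼ free))
      (↦-other V (⟦ χ ⟧ᶠ V) λ Y≡U → acyclic zero zero z≤n (subst (λ Y → Free Y χ) Y≡U free))

  ⟪⟫-look : ∀ (Δ : DefList Act) {V U ψ} → IsDefList Δ → look Δ U ≡ just ψ →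
    (V ⟪ Δ ⟫) U ≗ ⟦ ψ ⟧ᶠ (V ⟪ Δ ⟫)
  ⟪⟫-look [] _ ()
  ⟪⟫-look ((W , χ) ∷ Δ) {V} {U} dl eq with W == U | proof (W ≟ U) | eq
  ... | true  | ofʸ refl | refl = ⟪⟫-head W χ Δ dl
  ... | false | _        | eq′  = ⟪⟫-look Δ (IsDefList-tail dl) eq′

  ⟪⟫-snoc : ∀ (Δ : DefList Act) {V U ψ} → (V ⟪ Δ ++ [ (U , ψ) ] ⟫) U ≡ ⟦ ψ ⟧ᶠ (V ⟪ Δ ⟫)
  ⟪⟫-snoc []            {V} {U} {ψ} = ↦-same V U (⟦ ψ ⟧ᶠ V)
  ⟪⟫-snoc ((W , χ) ∷ Δ) = ⟪⟫-snoc Δ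

  step-sound : ∀ V {c cs} → IsDefList (defs c) → Step c cs →
    All (Valid lem 𝒯 V) cs → Valid lem 𝒯 V c
  step-sound V _ ∧-rule (v₁ ∷ v₂ ∷ []) s Ss = from T-∧ (v₁ s Ss , v₂ s Ss)
  step-sound V _ (∨-rule S⊆S₁∪S₂) (v₁ ∷ v₂ ∷ []) s Ss =
    not-∧-not-intro _ _ (Sum.map (v₁ s) (v₂ s) (proj₁ S⊆S₁∪S₂ Ss))
  step-sound V _ (box-rule S′≐post) (v ∷ []) s Ss =
    decide λ s′ step → v s′ (proj₂ S′≐post (s , Ss , step))
  step-sound V _ (dia-rule f f-step S′≐image) (v ∷ []) s Ss = T-not⁺ λ none →
    T-not⁻ (decided none (f s Ss) (f-step s Ss)) (v (f s Ss) (proj₂ S′≐image (s , Ss , refl)))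
  step-sound V _ (ν-rule {Δ = Δ} _ _) (v ∷ []) s Ss = subst T (cong-app (⟪⟫-snoc Δ) s) (v s Ss)
  step-sound V _ (μ-rule {Δ = Δ} _ _) (v ∷ []) s Ss = subst T (cong-app (⟪⟫-snoc Δ) s) (v s Ss)
  step-sound V dl (Un-ν {Δ = Δ} {Z = Z} {φ} Δ⟨U⟩) (v ∷ []) s Ss =
    let (unbound , nonneg , _) = look-wf Δ dl Δ⟨U⟩ in
    rename-⊑-prefixpoint φ (nu Z ⌜ φ ⌝) (unbound ∘ inj₂)
      (⟪⟫-look Δ dl Δ⟨U⟩) (nu-fold ⌜ φ ⌝ nonneg) s (v s Ss)
  step-sound V dl (Un-μ {Δ = Δ} {U = U} {Z} {φ} Δ⟨U⟩) (v ∷ []) s Ss =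
    let (unbound , nonneg , _) = look-wf Δ dl Δ⟨U⟩ in
    rename-⊑-prefixpoint φ (mu Z ⌜ φ ⌝) (unbound ∘ inj₂ ∘ Bound-sub⁺ ⌜ φ ⌝ Z (neg (var Z)) {U})
      (⟪⟫-look Δ dl Δ⟨U⟩) (mu-fold ⌜ φ ⌝ nonneg) s (v s Ss)
  step-sound V _ (Thin S⊆S′) (v ∷ []) s Ss = v s (S⊆S′ Ss)

lemma29 : (lem : LEM) {Act : Set} (𝒯 : LTS Act) (V : Valuation lem 𝒯)
          (𝕋 n : Tableau 𝒯) → _∈ₜ_ 𝒯 n 𝕋 → Internal 𝒯 n →
          All (λ c → Valid lem 𝒯 V (root 𝒯 c)) (children 𝒯 n) →
          Valid lem 𝒯 V (root 𝒯 n)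
lemma29 lem 𝒯 V 𝕋 (inode _ wf _ step) _ internal children-valid =
  step-sound lem 𝒯 V (proj₁ wf) step (map⁺ children-valid)
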